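{- Let $Y$ be a connected finite simple undirected graph with a cycle-edge $e=\{v,w\}$, and let $O\in\mathsf{Acyc}(Y)$ with $v\le_O w$. If $\mathbf{c}=c_1c_2\cdots c_m$ is a click-sequence for $O$ containing precisely one instance of $w$, and no instances of vertices from $\mathcal{I}(O)$ after that instance of $w$, then there exists a click-sequence $\mathbf{c}'=c'_1c'_2\cdots c'_m$ for $O$ such that (i) there is an interval $[p,q]$ of $\mathbb{N}$ with $c'_j\in\mathcal{I}(O)$ if and only if $p\le j\le q$, and (ii) $\mathbf{c}(O)=\mathbf{c}'(O)$.
   Context: $\mathsf{Acyc}(Y)$ is the set of acyclic orientations of $Y$. For $O\in\mathsf{Acyc}(Y)$, $i\le_O j$ means there is a directed path from $i$ to $j$ in $O$. When $v\le_O w$, $\mathcal{I}(O)$ is the set of vertices $c$ with $v\le_O c\le_O w$ (the vertices on directed paths from $v$ to $w$). A click on an acyclic orientation converts a source into a sink by reversing its incident edges. A click-sequence for $O$ is a sequence $c_1\cdots c_m$ of vertices such that each $c_i$ is a source of the orientation obtained from $O$ by successively clicking $c_1,\dots,c_{i-1}$; $\mathbf{c}(O)$ denotes the resulting orientation. -}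

module Defs where

open import Data.Nat using (ℕ; _≤_)
open import Data.Fin using (Fin; _≟_; toℕ)
open import Data.Bool using (Bool; true; false; if_then_else_; _∨_)
open import Data.List using (List; []; _∷_; _++_; length; foldl; lookup)
open import Data.List.Membership.Propositional using (_∈_; _∉_)
open import Data.List.Relation.Unary.All using (All)
open import Data.Product using (_×_; Σ; ∃; ∃-syntax)
open import Data.Sum using (_⊎_)
open import Relation.Nullary using (¬_; does)
open import Relation.Binary.PropositionalEquality using (_≡_)
open import Relation.Binary.Construct.Closure.ReflexiveTransitive using (Star)

record Graph (n : ℕ) : Set where
  field
    adj    : Fin n → Fin n → Bool
    sym    : ∀ i j → adj i j ≡ adj j i
    irrefl : ∀ i → adj i i ≡ false

open Graph public

Adj : ∀ {n} → Graph n → Fin n → Fin n → Set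
Adj G i j = adj G i j ≡ true

Walk : ∀ {n} → Graph n → Fin n → Fin n → Set
Walk G = Star (Adj G)

Connected : ∀ {n} → Graph n → Set
Connected G = ∀ i j → Walk G i j

data PathList {n} (G : Graph n) : Fin n → Fin n → List (Fin n) → Set where
  stop : ∀ a → PathList G a a (a ∷ [])
  step : ∀ {a b c us} → Adj G a b → PathList G b c us → PathList G a c (a ∷ us)

data Distinct {n} : List (Fin n) → Set where
  []  : Distinct []
  _∷_ : ∀ {u us} → u ∉ us → Distinct us → Distinct (u ∷ us)

-- {v,w} is a cycle-edge: it is an edge and lies on a cycle of Y, i.e.
-- there is a path w = u₀, u₁, …, u_k = v with k ≥ 2 and distinct vertices
-- (which together with the edge {v,w} forms a cycle).
CycleEdge : ∀ {n} → Graph n → Fin n → Fin n → Set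
CycleEdge G v w =
  Adj G v w ×
  ∃[ x ] ∃[ y ] ∃[ us ] (PathList G w v (w ∷ x ∷ y ∷ us) × Distinct (w ∷ x ∷ y ∷ us))

-- An orientation is a Boolean relation; O i j ≡ true means the edge {i,j}
-- is directed i → j.
Orientation : ℕ → Set
Orientation n = Fin n → Fin n → Bool

Arc : ∀ {n} → Orientation n → Fin n → Fin n → Set
Arc O i j = O i j ≡ true

_≤[_]_ : ∀ {n} → Fin n → Orientation n → Fin n → Set
i ≤[ O ] j = Star (Arc O) i j

record IsOrientation {n} (G : Graph n) (O : Orientation n) : Set where
  field
    arc⇒adj : ∀ i j → Arc O i j → Adj G i j
    adj⇒arc : ∀ i j → Adj G i j → Arc O i j ⊎ Arc O j i
    oneDir  : ∀ i j → Arc O i j → ¬ Arc O j i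

record IsAcyc {n} (G : Graph n) (O : Orientation n) : Set where
  field
    isOrientation : IsOrientation G O
    acyclic       : ∀ i j → Arc O i j → ¬ (j ≤[ O ] i)

-- c ∈ 𝓘(O) for the interval from v to w
InInterval : ∀ {n} → Orientation n → Fin n → Fin n → Fin n → Set
InInterval O v w c = v ≤[ O ] c × c ≤[ O ] w

IsSource : ∀ {n} → Orientation n → Fin n → Set
IsSource O c = ∀ j → O j c ≡ false

click : ∀ {n} → Orientation n → Fin n → Orientation n
click O c i j = if does (i ≟ c) ∨ does (j ≟ c) then O j i else O i j

clickSeq : ∀ {n} → Orientation n → List (Fin n) → Orientation n
clickSeq = foldl click

data IsClickSeq {n} : Orientation n → List (Fin n) → Set where
  []  : ∀ {O} → IsClickSeq O []
  _∷_ : ∀ {O c cs} → IsSource O c → IsClickSeq (click O c) cs → IsClickSeq O (c ∷ cs)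

_≐_ : ∀ {n} → Orientation n → Orientation n → Set
O ≐ O' = ∀ i j → O i j ≡ O' i j

-- Clicks on two distinct non-adjacent vertices commute, so it suffices to rearrange the
-- clicks before w by such transpositions.  Along a click sequence the clicks on the two
-- ends of an arc alternate, starting with its tail; as v → w and w is not clicked before
-- its instance, every vertex of 𝓘(O) is clicked at most once before it.  Scanning that
-- prefix we keep an equivalent sequence A I B, with I inside 𝓘(O), A and B outside it,
-- and no vertex of B adjacent to an unclicked vertex below w.  A new vertex of 𝓘(O) is
-- then independent of B and moves in front of it; an outside vertex moves into A when it
-- is independent of I B, and otherwise the alternation of clicks shows that it may join B.
-- Finally w joins I, and everything clicked after w lies outside 𝓘(O).
module Submission where

open import Defs hiding (sym)
open import Data.Bool using (Bool; true; false; if_then_else_; _∨_)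
open import Data.Bool.Properties using (∨-comm; ¬-not) renaming (_≟_ to _≟ᵇ_)
open import Data.Empty using (⊥-elim)
open import Data.Fin using (Fin; toℕ; _≟_) renaming (zero to fzero; suc to fsuc)
open import Data.Fin.Induction using (spo-noetherian)
open import Data.Fin.Properties using (any?)
open import Data.List using (List; []; _∷_; _++_; _∷ʳ_; [_]; length; lookup)
open import Data.List.Membership.Propositional using (_∈_; _∉_)
open import Data.List.Membership.Propositional.Properties using (∈-++⁺ˡ; ∈-++⁺ʳ; ∈-lookup)
open import Data.List.Properties using (++-assoc; ∷ʳ-++; foldl-++)
open import Data.List.Relation.Binary.Permutation.Propositional using (_↭_; ↭-refl; ↭-sym; ↭-trans; prep; swap)
open import Data.List.Relation.Binary.Permutation.Propositional.Properties using (∈-resp-↭; ↭-length; ++⁺ˡ; ++⁺ʳ)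
open import Data.List.Relation.Unary.All as All using (All; []; _∷_; all?)
open import Data.List.Relation.Unary.All.Properties using (++⁺; ∷ʳ⁺)
open import Data.List.Relation.Unary.Any using (here; there)
open import Data.List.Reverse using (Reverse; reverseView; []; _∶_∶ʳ_)
open import Data.Nat using (ℕ; suc; _+_; _≤_; z≤n; s≤s; s≤s⁻¹)
open import Data.Nat.Properties using (≤-refl; ≤-trans; ≤-reflexive; n≤1+n; n≤0⇒n≡0; m+n≤o⇒m≤o; +-comm)
open import Data.Product as Product using (_×_; _,_; proj₁; proj₂; ∃-syntax)
open import Data.Sum as Sum using (_⊎_; inj₁; inj₂)
open import Function using (_∘_)
open import Function.Bundles using (_⇔_; mk⇔; Equivalence)
open import Induction.WellFounded using (Acc; acc)
open import Relation.Binary.Construct.Closure.ReflexiveTransitive using (ε; _◅_; _◅◅_)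
open import Relation.Binary.PropositionalEquality using (_≡_; _≢_; refl; sym; trans; cong; cong₂; subst; subst₂; isEquivalence)
open import Relation.Binary.Structures using (IsStrictPartialOrder)
open import Relation.Nullary using (¬_; Dec; yes; no; does; contradiction)
open import Relation.Nullary.Decidable using (_×-dec_; ¬?)
open import Relation.Unary using (Decidable)

private
  variable
    n : ℕ
    G : Graph n
    O O′ : Orientation n
    a b c i j x y z : Fin n
    s t p r M : List (Fin n)

click-incident : ∀ {O : Orientation n} {c i j} → i ≡ c ⊎ j ≡ c → click O c i j ≡ O j i
click-incident {c = c} {i} {j} i∨j≡c with i ≟ c | j ≟ c | i∨j≡c
... | yes _   | _       | _         = refl
... | no _    | yes _   | _         = refl
... | no i≢c  | no _    | inj₁ i≡c  = contradiction i≡c i≢c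
... | no _    | no j≢c  | inj₂ j≡c  = contradiction j≡c j≢c

click-away : ∀ {O : Orientation n} {c i j} → i ≢ c → j ≢ c → click O c i j ≡ O i j
click-away {c = c} {i} {j} i≢c j≢c with i ≟ c | j ≟ c
... | yes i≡c | _       = contradiction i≡c i≢c
... | no _    | yes j≡c = contradiction j≡c j≢c
... | no _    | no _    = refl

click-pair : ∀ (O : Orientation n) c i j →
  (click O c i j ≡ O j i × click O c j i ≡ O i j) ⊎ (click O c i j ≡ O i j × click O c j i ≡ O j i)
click-pair O c i j with i ≟ c | j ≟ c
... | yes _ | yes _ = inj₁ (refl , refl)
... | yes _ | no _  = inj₁ (refl , refl)
... | no _  | yes _ = inj₁ (refl , refl)
... | no _  | no _  = inj₂ (refl , refl)

if-swap : ∀ {A : Set} (p q : Bool) (x y : A) →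
  (if q then (if p then x else y) else (if p then y else x)) ≡
  (if p then (if q then x else y) else (if q then y else x))
if-swap false false x y = refl
if-swap false true  x y = refl
if-swap true  false x y = refl
if-swap true  true  x y = refl

-- Each click reverses the edges incident to it, so an arc ij is reversed by the
-- composite iff exactly one of a, b lies in {i, j}: the order does not matter.
click-comm : ∀ (O : Orientation n) a b → click (click O a) b ≐ click (click O b) a
click-comm O a b i j
  rewrite ∨-comm (does (j ≟ a)) (does (i ≟ a)) | ∨-comm (does (j ≟ b)) (does (i ≟ b)) =
  if-swap (does (i ≟ a) ∨ does (j ≟ a)) (does (i ≟ b) ∨ does (j ≟ b)) (O i j) (O j i)

≐-refl : O ≐ O
≐-refl i j = refl

≐-trans : ∀ {O″ : Orientation n} → O ≐ O′ → O′ ≐ O″ → O ≐ O″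
≐-trans O≐O′ O′≐O″ i j = trans (O≐O′ i j) (O′≐O″ i j)

click-cong : ∀ c → O ≐ O′ → click O c ≐ click O′ c
click-cong c O≐O′ i j = cong₂ (if_then_else_ (does (i ≟ c) ∨ does (j ≟ c))) (O≐O′ j i) (O≐O′ i j)

clickSeq-cong : ∀ s → O ≐ O′ → clickSeq O s ≐ clickSeq O′ s
clickSeq-cong []      O≐O′ = O≐O′
clickSeq-cong (c ∷ s) O≐O′ = clickSeq-cong s (click-cong c O≐O′)

IsSource-cong : O ≐ O′ → IsSource O c → IsSource O′ c
IsSource-cong {c = c} O≐O′ src j = trans (sym (O≐O′ j c)) (src j)

IsClickSeq-cong : O ≐ O′ → IsClickSeq O s → IsClickSeq O′ s
IsClickSeq-cong O≐O′ []           = []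
IsClickSeq-cong O≐O′ (src ∷ rest) = IsSource-cong O≐O′ src ∷ IsClickSeq-cong (click-cong _ O≐O′) rest

IsClickSeq-++⁻ : ∀ s → IsClickSeq O (s ++ t) → IsClickSeq O s × IsClickSeq (clickSeq O s) t
IsClickSeq-++⁻ []      cs           = [] , cs
IsClickSeq-++⁻ (c ∷ s) (src ∷ rest) with IsClickSeq-++⁻ s rest
... | cs₁ , cs₂ = src ∷ cs₁ , cs₂

IsClickSeq-++⁺ : IsClickSeq O s → IsClickSeq (clickSeq O s) t → IsClickSeq O (s ++ t)
IsClickSeq-++⁺ []           cs = cs
IsClickSeq-++⁺ (src ∷ rest) cs = src ∷ IsClickSeq-++⁺ rest cs

IsClickSeq-∷ʳ⁻ : ∀ s → IsClickSeq O (s ∷ʳ x) → IsClickSeq O s × IsSource (clickSeq O s) x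
IsClickSeq-∷ʳ⁻ s cs with IsClickSeq-++⁻ s cs
... | cs-s , src ∷ [] = cs-s , src

clickSeq-++ : ∀ (O : Orientation n) s t → clickSeq O (s ++ t) ≡ clickSeq (clickSeq O s) t
clickSeq-++ = foldl-++ click

click-preserves-orientation : ∀ c → IsOrientation G O → IsOrientation G (click O c)
click-preserves-orientation {G = G} {O = O} c ori =
  record { arc⇒adj = arc⇒adj′ ; adj⇒arc = adj⇒arc′ ; oneDir = oneDir′ }
  where
  open IsOrientation ori
  adj-sym : ∀ i j → Adj G i j → Adj G j i
  adj-sym i j ij = trans (Graph.sym G j i) ij

  arc⇒adj′ : ∀ i j → Arc (click O c) i j → Adj G i j
  arc⇒adj′ i j arc with click-pair O c i j
  ... | inj₁ (e , _) = adj-sym j i (arc⇒adj j i (trans (sym e) arc))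
  ... | inj₂ (e , _) = arc⇒adj i j (trans (sym e) arc)

  adj⇒arc′ : ∀ i j → Adj G i j → Arc (click O c) i j ⊎ Arc (click O c) j i
  adj⇒arc′ i j ij with click-pair O c i j
  ... | inj₁ (e , e′) = Sum.map (trans e) (trans e′) (adj⇒arc j i (adj-sym i j ij))
  ... | inj₂ (e , e′) = Sum.map (trans e) (trans e′) (adj⇒arc i j ij)

  oneDir′ : ∀ i j → Arc (click O c) i j → ¬ Arc (click O c) j i
  oneDir′ i j ij ji with click-pair O c i j
  ... | inj₁ (e , e′) = oneDir j i (trans (sym e) ij) (trans (sym e′) ji)
  ... | inj₂ (e , e′) = oneDir i j (trans (sym e) ij) (trans (sym e′) ji)

clickSeq-preserves-orientation : ∀ s → IsOrientation G O → IsOrientation G (clickSeq O s)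
clickSeq-preserves-orientation []      ori = ori
clickSeq-preserves-orientation (c ∷ s) ori =
  clickSeq-preserves-orientation s (click-preserves-orientation c ori)

count : Fin n → List (Fin n) → ℕ
count x []      = 0
count x (y ∷ s) = if does (x ≟ y) then suc (count x s) else count x s

count-++ : ∀ x s t → count {n} x (s ++ t) ≡ count x s + count x t
count-++ x []      t = refl
count-++ x (y ∷ s) t with x ≟ y
... | yes _ = cong suc (count-++ x s t)
... | no _  = count-++ x s t

count-self : ∀ x → count {n} x [ x ] ≡ 1
count-self x with x ≟ x
... | yes _  = refl
... | no x≢x = contradiction refl x≢x

∉⇒count≡0 : x ∉ s → count x s ≡ 0
∉⇒count≡0 {s = []}    _   = refl
∉⇒count≡0 {x = x} {s = y ∷ s} x∉ with x ≟ y
... | yes x≡y = contradiction (here x≡y) x∉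
... | no _    = ∉⇒count≡0 (x∉ ∘ there)

count≡0⇒∉ : count x s ≡ 0 → x ∉ s
count≡0⇒∉ {x = x} {s = y ∷ s} #x≡0 x∈ with x ≟ y | x∈
... | yes _ | _          with () ← #x≡0
... | no x≢y | here x≡y  = x≢y x≡y
... | no _   | there x∈s = count≡0⇒∉ #x≡0 x∈s

∉-of-count-∷ʳ≤1 : count x (s ∷ʳ x) ≤ 1 → x ∉ s
∉-of-count-∷ʳ≤1 {x = x} {s = s} #x≤1 = count≡0⇒∉ (n≤0⇒n≡0 (s≤s⁻¹ (subst (_≤ 1) eq #x≤1)))
  where
  eq : count x (s ∷ʳ x) ≡ suc (count x s)
  eq = trans (count-++ x s [ x ]) (trans (cong (count x s +_) (count-self x)) (+-comm (count x s) 1))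

count-arc : IsClickSeq O s → Arc O i j →
  (count i s ≡ count j s × Arc (clickSeq O s) i j) ⊎
  (count i s ≡ suc (count j s) × Arc (clickSeq O s) j i)
count-arc []                        ij = inj₁ (refl , ij)
count-arc {O = O} {s = c ∷ s} {i = i} {j = j} (src ∷ cs) ij with i ≟ c | j ≟ c
... | _        | yes refl = contradiction (trans (sym ij) (src i)) λ ()
... | yes refl | no _ with count-arc cs (trans (click-incident {O = O} {i = j} (inj₂ refl)) ij)
...   | inj₁ (#j≡#i , ji) = inj₂ (cong suc (sym #j≡#i) , ji)
...   | inj₂ (#j≡1+#i , ij′) = inj₁ (sym #j≡1+#i , ij′)
count-arc {O = O} (src ∷ cs) ij | no i≢c | no j≢c = count-arc cs (trans (click-away {O = O} i≢c j≢c) ij)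

count-antitone : IsClickSeq O s → i ≤[ O ] j → count j s ≤ count i s
count-antitone cs ε = ≤-refl
count-antitone cs (ik ◅ k≤j) with count-arc cs ik
... | inj₁ (#i≡#k , _) = ≤-trans (count-antitone cs k≤j) (≤-reflexive (sym #i≡#k))
... | inj₂ (#i≡1+#k , _) =
  ≤-trans (count-antitone cs k≤j) (≤-trans (n≤1+n _) (≤-reflexive (sym #i≡1+#k)))

unclicked-downward : IsClickSeq O s → i ≤[ O ] j → i ∉ s → j ∉ s
unclicked-downward cs i≤j i∉s =
  count≡0⇒∉ (n≤0⇒n≡0 (≤-trans (count-antitone cs i≤j) (≤-reflexive (∉⇒count≡0 i∉s))))

unclicked-arc : IsClickSeq O s → Arc O i j → i ∉ s → Arc (clickSeq O s) i j
unclicked-arc cs ij i∉s with count-arc cs ij | ∉⇒count≡0 i∉s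
... | inj₁ (_ , ij′) | _ = ij′
... | inj₂ (#i≡1+#j , _) | #i≡0 with () ← trans (sym #i≡1+#j) #i≡0

count-below-arc≤1 : IsClickSeq O s → Arc O a b → b ∉ s → a ≤[ O ] x → count x s ≤ 1
count-below-arc≤1 {s = s} {a = a} {b = b} cs ab b∉s a≤x = ≤-trans (count-antitone cs a≤x) #a≤1
  where
  #a≤1 : count a s ≤ 1
  #a≤1 with count-arc cs ab | ∉⇒count≡0 b∉s
  ... | inj₁ (#a≡#b , _) | #b≡0 = ≤-trans (≤-reflexive (trans #a≡#b #b≡0)) z≤n
  ... | inj₂ (#a≡1+#b , _) | #b≡0 = ≤-reflexive (trans #a≡1+#b (cong suc #b≡0))

source-adjacent-to-unclicked : IsOrientation G O → IsClickSeq O s → IsSource (clickSeq O s) x →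
  Adj G x y → y ∉ s → Arc O x y × x ∉ s
source-adjacent-to-unclicked {x = x} {y = y} ori cs src xy y∉s with IsOrientation.adj⇒arc ori x y xy
... | inj₂ yx with () ← trans (sym (unclicked-arc cs yx y∉s)) (src y)
... | inj₁ xy′ with count-arc cs xy′
...   | inj₁ (#x≡#y , _) = xy′ , count≡0⇒∉ (trans #x≡#y (∉⇒count≡0 y∉s))
...   | inj₂ (_ , yx)  with () ← trans (sym yx) (src y)

arc-from-clicked : IsOrientation G O → IsClickSeq O s → z ∈ s → x ∉ s → Adj G z x → Arc O z x
arc-from-clicked {z = z} {x = x} ori cs z∈s x∉s zx with IsOrientation.adj⇒arc ori z x zx
... | inj₁ zx′ = zx′
... | inj₂ xz  = contradiction z∈s (unclicked-downward cs (xz ◅ ε) x∉s)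

Acyclic : Orientation n → Set
Acyclic O = ∀ i j → Arc O i j → ¬ (j ≤[ O ] i)

≤[]-dec : ∀ {n} {O : Orientation n} → Acyclic O → ∀ i j → Dec (i ≤[ O ] j)
≤[]-dec {n = n} {O = O} acyclic i j = search i (spo-noetherian ⊏-isStrictPartialOrder i)
  where
  _⊏_ : Fin n → Fin n → Set
  i ⊏ j = ∃[ k ] (Arc O i k × k ≤[ O ] j)

  ⊏-isStrictPartialOrder : IsStrictPartialOrder _≡_ _⊏_
  ⊏-isStrictPartialOrder = record
    { isEquivalence = isEquivalence
    ; irrefl        = λ { refl (k , ik , k≤i) → acyclic _ k ik k≤i }
    ; trans         = λ { (k , ik , k≤j) (l , jl , l≤m) → k , ik , k≤j ◅◅ (jl ◅ l≤m) }
    ; <-resp-≈      = (λ { refl i⊏j → i⊏j }) , (λ { refl i⊏j → i⊏j })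
    }

  search : ∀ i → Acc (λ k l → l ⊏ k) i → Dec (i ≤[ O ] j)
  search i (acc rec) with i ≟ j
  ... | yes refl = yes ε
  ... | no i≢j with any? through
    where
    through : ∀ k → Dec (Arc O i k × k ≤[ O ] j)
    through k with O i k in ik
    ... | false = no λ { (() , _) }
    ... | true with search k (rec (k , ik , ε))
    ...   | yes k≤j = yes (refl , k≤j)
    ...   | no k≰j  = no (k≰j ∘ proj₂)
  ... | yes (k , ik , k≤j) = yes (ik ◅ k≤j)
  ... | no ¬through = no λ { ε → i≢j refl ; (ik ◅ k≤j) → ¬through (_ , ik , k≤j) }

Independent : Graph n → Fin n → Fin n → Set
Independent G a b = a ≢ b × ¬ Adj G a b

independent? : ∀ (G : Graph n) a b → Dec (Independent G a b)
independent? G a b = ¬? (a ≟ b) ×-dec ¬? (adj G a b ≟ᵇ true)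

no-arc : IsOrientation G O → ¬ Adj G a b → O a b ≡ false
no-arc ori ¬ab = ¬-not (¬ab ∘ IsOrientation.arc⇒adj ori _ _)

swap-sources : IsOrientation G O → Independent G a b → IsSource O a → IsSource (click O a) b →
  IsSource O b × IsSource (click O b) a
swap-sources {G = G} {O = O} {a = a} {b = b} ori (a≢b , ¬ab) src-a src-b = src-b′ , src-a′
  where
  src-b′ : IsSource O b
  src-b′ j with j ≟ a
  ... | yes refl = no-arc ori ¬ab
  ... | no j≢a   = trans (sym (click-away {O = O} j≢a (a≢b ∘ sym))) (src-b j)

  src-a′ : IsSource (click O b) a
  src-a′ j = by-cases (j ≟ b)
    where
    by-cases : Dec (j ≡ b) → click O b j a ≡ false
    by-cases (yes refl) = trans (click-incident {O = O} (inj₁ refl)) (no-arc ori ¬ab)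
    by-cases (no j≢b)   = trans (click-away {O = O} j≢b a≢b) (src-a j)

infix 4 _≈[_]_

record _≈[_]_ (s : List (Fin n)) (O : Orientation n) (t : List (Fin n)) : Set where
  field
    validˡ      : IsClickSeq O s
    validʳ      : IsClickSeq O t
    same-result : clickSeq O s ≐ clickSeq O t
    permutation : s ↭ t

open _≈[_]_

≈-refl : IsClickSeq O s → s ≈[ O ] s
≈-refl cs = record { validˡ = cs ; validʳ = cs ; same-result = ≐-refl ; permutation = ↭-refl }

≈-trans : s ≈[ O ] t → t ≈[ O ] r → s ≈[ O ] r
≈-trans s≈t t≈r = record
  { validˡ      = validˡ s≈t
  ; validʳ      = validʳ t≈r
  ; same-result = ≐-trans (same-result s≈t) (same-result t≈r)
  ; permutation = ↭-trans (permutation s≈t) (permutation t≈r)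
  }

≈-++ʳ : s ≈[ O ] t → IsClickSeq (clickSeq O s) r → s ++ r ≈[ O ] t ++ r
≈-++ʳ {s = s} {O = O} {t = t} {r = r} s≈t cs = record
  { validˡ      = IsClickSeq-++⁺ (validˡ s≈t) cs
  ; validʳ      = IsClickSeq-++⁺ (validʳ s≈t) (IsClickSeq-cong (same-result s≈t) cs)
  ; same-result = subst₂ _≐_ (sym (clickSeq-++ O s r)) (sym (clickSeq-++ O t r))
                    (clickSeq-cong r (same-result s≈t))
  ; permutation = ++⁺ʳ r (permutation s≈t)
  }

≈-++ˡ : IsClickSeq O p → s ≈[ clickSeq O p ] t → p ++ s ≈[ O ] p ++ t
≈-++ˡ {O = O} {p = p} {s = s} {t = t} cs s≈t = record
  { validˡ      = IsClickSeq-++⁺ cs (validˡ s≈t)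
  ; validʳ      = IsClickSeq-++⁺ cs (validʳ s≈t)
  ; same-result = subst₂ _≐_ (sym (clickSeq-++ O p s)) (sym (clickSeq-++ O p t)) (same-result s≈t)
  ; permutation = ++⁺ˡ p (permutation s≈t)
  }

≈-move : IsOrientation G O → All (λ z → Independent G z x) M → IsClickSeq O (M ∷ʳ x) →
  M ∷ʳ x ≈[ O ] x ∷ M
≈-move ori []              cs           = ≈-refl cs
≈-move {O = O} {x = x} {M = z ∷ M} ori (zx ∷ zsx) (src-z ∷ cs)
  with ≈-move (click-preserves-orientation z ori) zsx cs
... | M∷ʳx≈x∷M with validʳ M∷ʳx≈x∷M
...   | src-x ∷ cs′ with swap-sources ori zx src-z src-x
...     | src-x′ , src-z′ = record
  { validˡ      = src-z ∷ cs
  ; validʳ      = src-x′ ∷ src-z′ ∷ IsClickSeq-cong (click-comm O z x) cs′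
  ; same-result = ≐-trans (same-result M∷ʳx≈x∷M) (clickSeq-cong M (click-comm O z x))
  ; permutation = ↭-trans (prep z (permutation M∷ʳx≈x∷M)) (swap z x ↭-refl)
  }

≈-move-after : IsOrientation G O → All (λ z → Independent G z x) M →
  s ≈[ O ] p ++ (M ∷ʳ x) → s ≈[ O ] p ++ x ∷ M
≈-move-after {O = O} {p = p} ori ind s≈pMx with IsClickSeq-++⁻ p (validʳ s≈pMx)
... | cs-p , cs-Mx = ≈-trans s≈pMx
  (≈-++ˡ cs-p (≈-move (clickSeq-preserves-orientation p ori) ind cs-Mx))

arc-along-reachability : IsAcyc G O → Adj G a b → a ≤[ O ] b → Arc O a b
arc-along-reachability acyc ab a≤b with IsOrientation.adj⇒arc (IsAcyc.isOrientation acyc) _ _ ab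
... | inj₁ ab′ = ab′
... | inj₂ ba  = contradiction a≤b (IsAcyc.acyclic acyc _ _ ba)

module _ {A : Set} {P : A → Set} where

  lookup-outside : ∀ {xs} → All (¬_ ∘ P) xs → ∀ k → ¬ P (lookup xs k)
  lookup-outside ¬pxs k = All.lookup ¬pxs (∈-lookup k)

  lookup-initial-block : ∀ {ys y zs} → All P ys → P y → All (¬_ ∘ P) zs →
    ∀ k → P (lookup ((ys ∷ʳ y) ++ zs) k) ⇔ toℕ k ≤ length ys
  lookup-initial-block []         py ¬pzs fzero    = mk⇔ (λ _ → z≤n) (λ _ → py)
  lookup-initial-block []         py ¬pzs (fsuc k) = mk⇔ (⊥-elim ∘ lookup-outside ¬pzs k) λ ()
  lookup-initial-block (py′ ∷ _)  py ¬pzs fzero    = mk⇔ (λ _ → z≤n) (λ _ → py′)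
  lookup-initial-block (_ ∷ pys)  py ¬pzs (fsuc k) = mk⇔ (s≤s ∘ to) (from ∘ s≤s⁻¹)
    where open Equivalence (lookup-initial-block pys py ¬pzs k)

  lookup-block : ∀ {xs ys y zs} → All (¬_ ∘ P) xs → All P ys → P y → All (¬_ ∘ P) zs →
    ∀ k → P (lookup (xs ++ (ys ∷ʳ y) ++ zs) k) ⇔ (length xs ≤ toℕ k × toℕ k ≤ length xs + length ys)
  lookup-block []          pys py ¬pzs k        = mk⇔ (λ pk → z≤n , to pk) (from ∘ proj₂)
    where open Equivalence (lookup-initial-block pys py ¬pzs k)
  lookup-block (¬px ∷ _)   pys py ¬pzs fzero    = mk⇔ (⊥-elim ∘ ¬px) λ { (() , _) }
  lookup-block (_ ∷ ¬pxs)  pys py ¬pzs (fsuc k) =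
    mk⇔ (Product.map s≤s s≤s ∘ to) (from ∘ Product.map s≤s⁻¹ s≤s⁻¹)
    where open Equivalence (lookup-block ¬pxs pys py ¬pzs k)

module Interval {n} (G : Graph n) (O : Orientation n) (acyc : IsAcyc G O) (v w : Fin n) where
  open IsAcyc acyc using (isOrientation; acyclic)

  𝓘 : Fin n → Set
  𝓘 = InInterval O v w

  𝓘? : Decidable 𝓘
  𝓘? x = ≤[]-dec acyclic v x ×-dec ≤[]-dec acyclic x w

  Settled : List (Fin n) → Fin n → Set
  Settled p b = ∀ y → y ∉ p → y ≤[ O ] w → ¬ Adj G b y

  record Arrangement (p : List (Fin n)) : Set where
    field
      A I B      : List (Fin n)
      equivalent : p ≈[ O ] A ++ I ++ B
      A-outside  : All (¬_ ∘ 𝓘) A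
      I-inside   : All 𝓘 I
      B-outside  : All (¬_ ∘ 𝓘) B
      B-settled  : All (Settled p) B

  settled-∷ʳ : Settled p b → Settled (p ∷ʳ x) b
  settled-∷ʳ settled y y∉px = settled y (y∉px ∘ ∈-++⁺ˡ)

  settled-independent : x ∉ p → 𝓘 x → ¬ 𝓘 b × Settled p b → Independent G b x
  settled-independent x∉p x∈𝓘 (b∉𝓘 , settled) = (λ { refl → b∉𝓘 x∈𝓘 }) , settled _ x∉p (proj₂ x∈𝓘)

  module Extend {p} (arr : Arrangement p) {x} (src : IsSource (clickSeq O p) x) where
    open Arrangement arr

    appended : p ∷ʳ x ≈[ O ] A ++ I ++ (B ∷ʳ x)
    appended = subst (p ∷ʳ x ≈[ O ]_) reassociate (≈-++ʳ equivalent (src ∷ []))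
      where
      reassociate : (A ++ I ++ B) ∷ʳ x ≡ A ++ I ++ (B ∷ʳ x)
      reassociate = trans (++-assoc A (I ++ B) [ x ]) (cong (A ++_) (++-assoc I B [ x ]))

    into-I : 𝓘 x → x ∉ p → p ∷ʳ x ≈[ O ] A ++ (I ∷ʳ x) ++ B
    into-I x∈𝓘 x∉p =
      subst (p ∷ʳ x ≈[ O ]_) (trans (++-assoc A I (x ∷ B)) (cong (A ++_) (sym (∷ʳ-++ I x B))))
      (≈-move-after isOrientation
        (All.zipWith (settled-independent x∉p x∈𝓘) (B-outside , B-settled))
        (subst (p ∷ʳ x ≈[ O ]_) (sym (++-assoc A I (B ∷ʳ x))) appended))

    into-A : All (λ z → Independent G z x) (I ++ B) → p ∷ʳ x ≈[ O ] (A ∷ʳ x) ++ I ++ B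
    into-A independent = subst (p ∷ʳ x ≈[ O ]_) (sym (∷ʳ-++ A x (I ++ B)))
      (≈-move-after isOrientation independent
        (subst (p ∷ʳ x ≈[ O ]_) (cong (A ++_) (sym (++-assoc I B [ x ]))) appended))

    blocked⇒settled : ¬ 𝓘 x → ¬ All (λ z → Independent G z x) (I ++ B) → Settled (p ∷ʳ x) x
    blocked⇒settled x∉𝓘 ¬independent y y∉px y≤w xy =
      ¬independent (++⁺ (All.tabulate I-independent) (All.tabulate B-independent))
      where
      y∉t : y ∉ A ++ I ++ B
      y∉t = y∉px ∘ ∈-++⁺ˡ ∘ ∈-resp-↭ (↭-sym (permutation equivalent))
      unclicked-arc-xy : Arc O x y × x ∉ A ++ I ++ B
      unclicked-arc-xy = source-adjacent-to-unclicked isOrientation (validʳ equivalent)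
                           (IsSource-cong (same-result equivalent) src) xy y∉t
      x∉t : x ∉ A ++ I ++ B
      x∉t = proj₂ unclicked-arc-xy
      x≤w : x ≤[ O ] w
      x≤w = proj₁ unclicked-arc-xy ◅ y≤w
      distinct : z ∈ A ++ I ++ B → z ≢ x
      distinct z∈t refl = x∉t z∈t
      I-independent : z ∈ I → Independent G z x
      I-independent z∈I = distinct z∈t , λ zx →
        let zx′ = arc-from-clicked isOrientation (validʳ equivalent) z∈t x∉t zx
        in x∉𝓘 (proj₁ (All.lookup I-inside z∈I) ◅◅ (zx′ ◅ ε) , x≤w)
        where z∈t = ∈-++⁺ʳ A (∈-++⁺ˡ z∈I)
      B-independent : z ∈ B → Independent G z x
      B-independent z∈B = distinct (∈-++⁺ʳ A (∈-++⁺ʳ I z∈B)) ,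
        All.lookup B-settled z∈B x (x∉t ∘ ∈-resp-↭ (permutation equivalent)) x≤w

    extend : (𝓘 x → x ∉ p) → Arrangement (p ∷ʳ x)
    extend fresh with 𝓘? x
    ... | yes x∈𝓘 = record
      { A = A ; I = I ∷ʳ x ; B = B ; equivalent = into-I x∈𝓘 (fresh x∈𝓘)
      ; A-outside = A-outside ; I-inside = ∷ʳ⁺ I-inside x∈𝓘 ; B-outside = B-outside
      ; B-settled = All.map settled-∷ʳ B-settled }
    ... | no x∉𝓘 with all? (λ z → independent? G z x) (I ++ B)
    ...   | yes independent = record
      { A = A ∷ʳ x ; I = I ; B = B ; equivalent = into-A independent
      ; A-outside = ∷ʳ⁺ A-outside x∉𝓘 ; I-inside = I-inside ; B-outside = B-outside
      ; B-settled = All.map settled-∷ʳ B-settled }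
    ...   | no ¬independent = record
      { A = A ; I = I ; B = B ∷ʳ x ; equivalent = appended
      ; A-outside = A-outside ; I-inside = I-inside ; B-outside = ∷ʳ⁺ B-outside x∉𝓘
      ; B-settled = ∷ʳ⁺ (All.map settled-∷ʳ B-settled) (blocked⇒settled x∉𝓘 ¬independent) }

  arrange : Reverse p → IsClickSeq O p → (∀ x → 𝓘 x → count x p ≤ 1) → Arrangement p
  arrange [] _ _ = record
    { A = [] ; I = [] ; B = [] ; equivalent = ≈-refl []
    ; A-outside = [] ; I-inside = [] ; B-outside = [] ; B-settled = [] }
  arrange (p ∶ p-view ∶ʳ x) cs at-most-once with IsClickSeq-∷ʳ⁻ p cs
  ... | cs-p , src =
    Extend.extend (arrange p-view cs-p at-most-once-in-p) src (∉-of-count-∷ʳ≤1 ∘ at-most-once x)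
    where
    at-most-once-in-p : ∀ y → 𝓘 y → count y p ≤ 1
    at-most-once-in-p y y∈𝓘 =
      m+n≤o⇒m≤o (count y p) (subst (_≤ 1) (count-++ y p [ x ]) (at-most-once y y∈𝓘))

proposition8 : ∀ {n} (G : Graph n) → Connected G →
    ∀ (v w : Fin n) → CycleEdge G v w →
    ∀ (O : Orientation n) → IsAcyc G O → v ≤[ O ] w →
    ∀ (pre post : List (Fin n)) →
    IsClickSeq O (pre ++ w ∷ post) →
    w ∉ pre → w ∉ post →
    All (λ c → ¬ InInterval O v w c) post →
    ∃[ cs' ] (IsClickSeq O cs' × length cs' ≡ length (pre ++ w ∷ post) ×
    (∃[ p ] ∃[ q ] ∀ (j : Fin (length cs')) →
    (InInterval O v w (lookup cs' j) ⇔ (p ≤ toℕ j × toℕ j ≤ q))) ×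
    clickSeq O (pre ++ w ∷ post) ≐ clickSeq O cs')
proposition8 G _ v w (vw , _) O acyc v≤w pre post cs w∉pre _ post-outside =
  A ++ (I ∷ʳ w) ++ (B ++ post) , validʳ rearranged , sym (↭-length (permutation rearranged)) ,
  (length A , length A + length I ,
   lookup-block A-outside I-inside (v≤w , ε) (++⁺ B-outside post-outside)) ,
  same-result rearranged
  where
  open Interval G O acyc v w
  cs-pre-w-post : IsClickSeq O (pre ∷ʳ w) × IsClickSeq (clickSeq O (pre ∷ʳ w)) post
  cs-pre-w-post = IsClickSeq-++⁻ (pre ∷ʳ w) (subst (IsClickSeq O) (sym (∷ʳ-++ pre w post)) cs)
  cs-pre-w : IsClickSeq O pre × IsSource (clickSeq O pre) w
  cs-pre-w = IsClickSeq-∷ʳ⁻ pre (proj₁ cs-pre-w-post)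
  arrangement : Arrangement pre
  arrangement = arrange (reverseView pre) (proj₁ cs-pre-w) λ x x∈𝓘 →
    count-below-arc≤1 (proj₁ cs-pre-w) (arc-along-reachability acyc vw v≤w) w∉pre (proj₁ x∈𝓘)
  open Arrangement arrangement
  rearranged : pre ++ w ∷ post ≈[ O ] A ++ (I ∷ʳ w) ++ (B ++ post)
  rearranged = subst₂ _≈[ O ]_ (∷ʳ-++ pre w post)
    (trans (++-assoc A ((I ∷ʳ w) ++ B) post) (cong (A ++_) (++-assoc (I ∷ʳ w) B post)))
    (≈-++ʳ (Extend.into-I arrangement (proj₂ cs-pre-w) (v≤w , ε) w∉pre) (proj₂ cs-pre-w-post))
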